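{- For every context $\Gamma$, term $r$ and types $A,B$ such that $\Gamma\vdash r:A$ and $\Gamma\vdash r:B$, we have $A\equiv B$.
   Context: Types: $A ::= X \mid A\Rightarrow A \mid A\wedge A \mid \forall X.A$ ($X$ type variables, $FTV$ free type variables, modulo $\alpha$-equivalence). Type isomorphism $\equiv$ is the smallest congruence on types containing: $A\wedge B\equiv B\wedge A$; $A\wedge(B\wedge C)\equiv(A\wedge B)\wedge C$; $A\Rightarrow(B\wedge C)\equiv(A\Rightarrow B)\wedge(A\Rightarrow C)$; $(A\wedge B)\Rightarrow C\equiv A\Rightarrow B\Rightarrow C$; $\forall X.(A\Rightarrow B)\equiv A\Rightarrow\forall X.B$ if $X\notin FTV(A)$; $\forall X.(A\wedge B)\equiv\forall X.A\wedge\forall X.B$. Terms (Church style): $r ::= x^A \mid \lambda x^A.r \mid rr \mid \langle r,r\rangle \mid \pi_A(r) \mid \Lambda X.r \mid r[A]$. Typing rules: $\Gamma,x:A\vdash x:A$; from $\Gamma\vdash r:A$, $A\equiv B$ infer $\Gamma\vdash r:B$; from $\Gamma,x:A\vdash r:B$ infer $\Gamma\vdash\lambda x^A.r:A\Rightarrow B$; from $\Gamma\vdash r:A\Rightarrow B$, $\Gamma\vdash s:A$ infer $\Gamma\vdash rs:B$; from $\Gamma\vdash r:A$, $\Gamma\vdash s:B$ infer $\Gamma\vdash\langle r,s\rangle:A\wedge B$; from $\Gamma\vdash r:A\wedge B$ infer $\Gamma\vdash\pi_A(r):A$; from $\Gamma\vdash r:A$, $X\notin FTV(\Gamma)$ infer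 $\Gamma\vdash\Lambda X.r:\forall X.A$; from $\Gamma\vdash r:\forall X.A$ infer $\Gamma\vdash r[B]:[X:=B]A$. -}

module Defs where

open import Data.Nat using (ℕ; zero; suc)
open import Data.List using (List; map)
open import Data.Maybe using (Maybe; just; nothing)

infixr 7 _⇒_
infixr 8 _∧_

-- Types, type variables as de Bruijn indices (so α-equivalence is ≡).
data Ty : Set where
  tv  : ℕ → Ty
  _⇒_ : Ty → Ty → Ty
  _∧_ : Ty → Ty → Ty
  ∀'  : Ty → Ty          -- ∀X.A, X is index 0 in A

ext : (ℕ → ℕ) → ℕ → ℕ
ext ρ zero    = zero
ext ρ (suc n) = suc (ρ n)

rename : (ℕ → ℕ) → Ty → Ty
rename ρ (tv n)  = tv (ρ n)
rename ρ (A ⇒ B) = rename ρ A ⇒ rename ρ B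
rename ρ (A ∧ B) = rename ρ A ∧ rename ρ B
rename ρ (∀' A)  = ∀' (rename (ext ρ) A)

-- shift: weaken a type by one fresh (bound) variable, i.e. X ∉ FTV
shift : Ty → Ty
shift = rename suc

exts : (ℕ → Ty) → ℕ → Ty
exts σ zero    = tv zero
exts σ (suc n) = shift (σ n)

subst : (ℕ → Ty) → Ty → Ty
subst σ (tv n)  = σ n
subst σ (A ⇒ B) = subst σ A ⇒ subst σ B
subst σ (A ∧ B) = subst σ A ∧ subst σ B
subst σ (∀' A)  = ∀' (subst (exts σ) A)

sub0 : Ty → ℕ → Ty
sub0 B zero    = B
sub0 B (suc n) = tv n

-- [X:=B]A where X is the variable bound by the ∀
_[_]₀ : Ty → Ty → Ty
A [ B ]₀ = subst (sub0 B) A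

infix 4 _≅_
data _≅_ : Ty → Ty → Set where
  ≅-refl  : ∀ {A} → A ≅ A
  ≅-sym   : ∀ {A B} → A ≅ B → B ≅ A
  ≅-trans : ∀ {A B C} → A ≅ B → B ≅ C → A ≅ C
  ≅-⇒     : ∀ {A A' B B'} → A ≅ A' → B ≅ B' → A ⇒ B ≅ A' ⇒ B'
  ≅-∧     : ∀ {A A' B B'} → A ≅ A' → B ≅ B' → A ∧ B ≅ A' ∧ B'
  ≅-∀     : ∀ {A A'} → A ≅ A' → ∀' A ≅ ∀' A'
  comm    : ∀ {A B} → A ∧ B ≅ B ∧ A
  asso    : ∀ {A B C} → A ∧ (B ∧ C) ≅ (A ∧ B) ∧ C
  dist    : ∀ {A B C} → A ⇒ (B ∧ C) ≅ (A ⇒ B) ∧ (A ⇒ C)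
  curry   : ∀ {A B C} → (A ∧ B) ⇒ C ≅ A ⇒ B ⇒ C
  -- ∀X.(A ⇒ B) ≡ A ⇒ ∀X.B with X ∉ FTV(A): A appears shifted under the binder
  p-comm  : ∀ {A B} → ∀' (shift A ⇒ B) ≅ A ⇒ ∀' B
  p-dist  : ∀ {A B} → ∀' (A ∧ B) ≅ ∀' A ∧ ∀' B

-- Church-style terms; term variables are de Bruijn indices annotated by their type.
data Term : Set where
  var   : ℕ → Ty → Term
  lam   : Ty → Term → Term
  app   : Term → Term → Term
  pair  : Term → Term → Term
  proj  : Ty → Term → Term       -- π_A(r)
  tlam  : Term → Term
  tapp  : Term → Ty → Term

Ctx : Set
Ctx = List Ty

lookup : Ctx → ℕ → Maybe Ty
lookup List.[] n = nothing
lookup (A List.∷ Γ) zero = just A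
lookup (A List.∷ Γ) (suc n) = lookup Γ n

open import Relation.Binary.PropositionalEquality using (_≡_)

infix 3 _⊢_∶_
data _⊢_∶_ : Ctx → Term → Ty → Set where
  ax   : ∀ {Γ n A} → lookup Γ n ≡ just A → Γ ⊢ var n A ∶ A
  iso  : ∀ {Γ r A B} → Γ ⊢ r ∶ A → A ≅ B → Γ ⊢ r ∶ B
  ⇒I   : ∀ {Γ r A B} → (A List.∷ Γ) ⊢ r ∶ B → Γ ⊢ lam A r ∶ A ⇒ B
  ⇒E   : ∀ {Γ r s A B} → Γ ⊢ r ∶ A ⇒ B → Γ ⊢ s ∶ A → Γ ⊢ app r s ∶ B
  ∧I   : ∀ {Γ r s A B} → Γ ⊢ r ∶ A → Γ ⊢ s ∶ B → Γ ⊢ pair r s ∶ A ∧ B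
  ∧E   : ∀ {Γ r A B} → Γ ⊢ r ∶ A ∧ B → Γ ⊢ proj A r ∶ A
  -- X ∉ FTV(Γ): the body is typed in the context weakened by a fresh type variable
  ∀I   : ∀ {Γ r A} → map shift Γ ⊢ r ∶ A → Γ ⊢ tlam r ∶ ∀' A
  ∀E   : ∀ {Γ r A B} → Γ ⊢ r ∶ ∀' A → Γ ⊢ tapp r B ∶ A [ B ]₀

-- Induct on both derivations; uses of the conversion rule are absorbed by
-- transitivity, so only two cases need an idea.
--
-- Type application needs ∀X.A ≅ ∀X.B ⇒ A ≅ B. The map strip∀, which removes
-- the outermost ∀ of each conjunct's conclusion, sends both sides of every
-- axiom to isomorphic types and therefore respects ≅.
--
-- Application needs A ⇒ B ≅ A′ ⇒ B′ and A ≅ A′ ⇒ B ≅ B′. Every type is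
-- isomorphic to a conjunction of primes ∀X̄.(P₁ ⇒ … ⇒ Pₘ ⇒ Y), and this
-- factorisation is unique up to permuting conjuncts and premises (recursively):
-- nf is invariant under the axioms and ⋀ (nf A) ≅ A. Now nf (A ⇒ B) is nf B with
-- the primes of A added to the premises of each factor, an operation that is
-- injective up to permutation; hence nf B ↭ nf B′.
module Submission where

open import Defs
open import Data.Nat using (ℕ; zero; suc; _+_)
open import Data.Nat.Properties using (+-suc)
open import Data.List using (List; []; _∷_; _++_; map; [_])
open import Data.List.Properties using (map-++; ++-assoc; map-cong; map-∘)
open import Data.Maybe.Properties using (just-injective)
open import Data.Product using (_,_)
open import Data.Empty using (⊥; ⊥-elim)
open import Data.Unit using (⊤; tt)
open import Function using (_∘_)
open import Relation.Binary.Bundles using (Setoid)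
import Relation.Binary.Reasoning.Setoid
import Data.List.Relation.Binary.Pointwise as Pointwise
open Pointwise using (Pointwise; []; _∷_)
import Data.List.Relation.Binary.Equality.Setoid as ListEquality
import Data.List.Membership.Setoid.Properties as Membership
open import Data.List.Relation.Unary.Any using (here)
import Data.List.Relation.Binary.Permutation.Homogeneous as Perm
open Perm using (Permutation; prep; swap)
import Data.List.Relation.Binary.Permutation.Setoid as PermutationSetoid
import Data.List.Relation.Binary.Permutation.Setoid.Properties as PermutationProperties
open import Relation.Binary.PropositionalEquality
  using (_≡_; _≗_; refl; sym; trans; cong; cong₂; module ≡-Reasoning)

ext-cong : ∀ {ρ ρ′} → ρ ≗ ρ′ → ext ρ ≗ ext ρ′
ext-cong e zero    = refl
ext-cong e (suc n) = cong suc (e n)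

ext-∘ : ∀ ρ σ → ext ρ ∘ ext σ ≗ ext (ρ ∘ σ)
ext-∘ ρ σ zero    = refl
ext-∘ ρ σ (suc n) = refl

rename-cong : ∀ {ρ ρ′} → ρ ≗ ρ′ → rename ρ ≗ rename ρ′
rename-cong e (tv n)  = cong tv (e n)
rename-cong e (A ⇒ B) = cong₂ _⇒_ (rename-cong e A) (rename-cong e B)
rename-cong e (A ∧ B) = cong₂ _∧_ (rename-cong e A) (rename-cong e B)
rename-cong e (∀' A)  = cong ∀' (rename-cong (ext-cong e) A)

rename-∘ : ∀ ρ σ A → rename ρ (rename σ A) ≡ rename (ρ ∘ σ) A
rename-∘ ρ σ (tv n)  = refl
rename-∘ ρ σ (A ⇒ B) = cong₂ _⇒_ (rename-∘ ρ σ A) (rename-∘ ρ σ B)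
rename-∘ ρ σ (A ∧ B) = cong₂ _∧_ (rename-∘ ρ σ A) (rename-∘ ρ σ B)
rename-∘ ρ σ (∀' A)  =
  cong ∀' (trans (rename-∘ (ext ρ) (ext σ) A) (rename-cong (ext-∘ ρ σ) A))

rename-shift : ∀ ρ A → rename (ext ρ) (shift A) ≡ shift (rename ρ A)
rename-shift ρ A = trans (rename-∘ (ext ρ) suc A) (sym (rename-∘ suc ρ A))

exts-cong : ∀ {σ τ} → σ ≗ τ → exts σ ≗ exts τ
exts-cong e zero    = refl
exts-cong e (suc n) = cong shift (e n)

subst-cong : ∀ {σ τ} → σ ≗ τ → subst σ ≗ subst τ
subst-cong e (tv n)  = e n
subst-cong e (A ⇒ B) = cong₂ _⇒_ (subst-cong e A) (subst-cong e B)
subst-cong e (A ∧ B) = cong₂ _∧_ (subst-cong e A) (subst-cong e B)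
subst-cong e (∀' A)  = cong ∀' (subst-cong (exts-cong e) A)

subst-rename : ∀ σ ρ A → subst σ (rename ρ A) ≡ subst (σ ∘ ρ) A
subst-rename σ ρ (tv n)  = refl
subst-rename σ ρ (A ⇒ B) = cong₂ _⇒_ (subst-rename σ ρ A) (subst-rename σ ρ B)
subst-rename σ ρ (A ∧ B) = cong₂ _∧_ (subst-rename σ ρ A) (subst-rename σ ρ B)
subst-rename σ ρ (∀' A)  =
  cong ∀' (trans (subst-rename (exts σ) (ext ρ) A) (subst-cong exts-ext A))
  where
  exts-ext : exts σ ∘ ext ρ ≗ exts (σ ∘ ρ)
  exts-ext zero    = refl
  exts-ext (suc n) = refl

rename-subst : ∀ ρ σ A → rename ρ (subst σ A) ≡ subst (rename ρ ∘ σ) A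
rename-subst ρ σ (tv n)  = refl
rename-subst ρ σ (A ⇒ B) = cong₂ _⇒_ (rename-subst ρ σ A) (rename-subst ρ σ B)
rename-subst ρ σ (A ∧ B) = cong₂ _∧_ (rename-subst ρ σ A) (rename-subst ρ σ B)
rename-subst ρ σ (∀' A)  =
  cong ∀' (trans (rename-subst (ext ρ) (exts σ) A) (subst-cong rename-exts A))
  where
  rename-exts : rename (ext ρ) ∘ exts σ ≗ exts (rename ρ ∘ σ)
  rename-exts zero    = refl
  rename-exts (suc n) = rename-shift ρ (σ n)

subst-shift : ∀ σ A → subst (exts σ) (shift A) ≡ shift (subst σ A)
subst-shift σ A = trans (subst-rename (exts σ) suc A) (sym (rename-subst suc σ A))

≡⇒≅ : ∀ {A B} → A ≡ B → A ≅ B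
≡⇒≅ refl = ≅-refl

≅-setoid : Setoid _ _
≅-setoid = record
  { Carrier       = Ty
  ; _≈_           = _≅_
  ; isEquivalence = record { refl = ≅-refl ; sym = ≅-sym ; trans = ≅-trans }
  }

module ≅-Reasoning = Relation.Binary.Reasoning.Setoid ≅-setoid

rename-resp-≅ : ∀ ρ {A B} → A ≅ B → rename ρ A ≅ rename ρ B
rename-resp-≅ ρ ≅-refl        = ≅-refl
rename-resp-≅ ρ (≅-sym p)     = ≅-sym (rename-resp-≅ ρ p)
rename-resp-≅ ρ (≅-trans p q) = ≅-trans (rename-resp-≅ ρ p) (rename-resp-≅ ρ q)
rename-resp-≅ ρ (≅-⇒ p q)     = ≅-⇒ (rename-resp-≅ ρ p) (rename-resp-≅ ρ q)
rename-resp-≅ ρ (≅-∧ p q)     = ≅-∧ (rename-resp-≅ ρ p) (rename-resp-≅ ρ q)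
rename-resp-≅ ρ (≅-∀ p)       = ≅-∀ (rename-resp-≅ (ext ρ) p)
rename-resp-≅ ρ comm          = comm
rename-resp-≅ ρ asso          = asso
rename-resp-≅ ρ dist          = dist
rename-resp-≅ ρ curry         = curry
rename-resp-≅ ρ (p-comm {A})  = ≅-trans (≅-∀ (≅-⇒ (≡⇒≅ (rename-shift ρ A)) ≅-refl)) p-comm
rename-resp-≅ ρ p-dist        = p-dist

subst-resp-≅ : ∀ σ {A B} → A ≅ B → subst σ A ≅ subst σ B
subst-resp-≅ σ ≅-refl        = ≅-refl
subst-resp-≅ σ (≅-sym p)     = ≅-sym (subst-resp-≅ σ p)
subst-resp-≅ σ (≅-trans p q) = ≅-trans (subst-resp-≅ σ p) (subst-resp-≅ σ q)
subst-resp-≅ σ (≅-⇒ p q)     = ≅-⇒ (subst-resp-≅ σ p) (subst-resp-≅ σ q)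
subst-resp-≅ σ (≅-∧ p q)     = ≅-∧ (subst-resp-≅ σ p) (subst-resp-≅ σ q)
subst-resp-≅ σ (≅-∀ p)       = ≅-∀ (subst-resp-≅ (exts σ) p)
subst-resp-≅ σ comm          = comm
subst-resp-≅ σ asso          = asso
subst-resp-≅ σ dist          = dist
subst-resp-≅ σ curry         = curry
subst-resp-≅ σ (p-comm {A})  = ≅-trans (≅-∀ (≅-⇒ (≡⇒≅ (subst-shift σ A)) ≅-refl)) p-comm
subst-resp-≅ σ p-dist        = p-dist

-- The value on a bare variable is junk.
strip∀ : Ty → Ty
strip∀ (tv n)  = tv n
strip∀ (A ⇒ B) = shift A ⇒ strip∀ B
strip∀ (A ∧ B) = strip∀ A ∧ strip∀ B
strip∀ (∀' A)  = A

strip∀-resp-≅ : ∀ {A B} → A ≅ B → strip∀ A ≅ strip∀ B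
strip∀-resp-≅ ≅-refl        = ≅-refl
strip∀-resp-≅ (≅-sym p)     = ≅-sym (strip∀-resp-≅ p)
strip∀-resp-≅ (≅-trans p q) = ≅-trans (strip∀-resp-≅ p) (strip∀-resp-≅ q)
strip∀-resp-≅ (≅-⇒ p q)     = ≅-⇒ (rename-resp-≅ suc p) (strip∀-resp-≅ q)
strip∀-resp-≅ (≅-∧ p q)     = ≅-∧ (strip∀-resp-≅ p) (strip∀-resp-≅ q)
strip∀-resp-≅ (≅-∀ p)       = p
strip∀-resp-≅ comm          = comm
strip∀-resp-≅ asso          = asso
strip∀-resp-≅ dist          = dist
strip∀-resp-≅ curry         = curry
strip∀-resp-≅ p-comm        = ≅-refl
strip∀-resp-≅ p-dist        = ≅-refl

∀-cancel-≅ : ∀ {A B} → ∀' A ≅ ∀' B → A ≅ B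
∀-cancel-≅ = strip∀-resp-≅

module _ {c ℓ} (S : Setoid c ℓ) where
  open Setoid S using (_≈_) renaming (refl to ≈-refl; sym to ≈-sym; trans to ≈-trans)
  open PermutationSetoid S
    using (_↭_; ↭-refl; ↭-sym; ↭-trans; ↭-reflexive; ↭-prep; module PermutationReasoning)
  open PermutationProperties S using (¬x∷xs↭[]; ∈-resp-↭; dropMiddleElement; ↭-shift; ++⁺ˡ)
  open ListEquality S using (map⁺)
  open Membership using (∈-map⁻; ∈-∃++)

  map-cancel-↭ : ∀ {f} → (∀ {x y} → x ≈ y → f x ≈ f y) → (∀ {x y} → f x ≈ f y → x ≈ y) →
                 ∀ xs {ys} → map f xs ↭ map f ys → xs ↭ ys
  map-cancel-↭ f-cong f-inj [] {[]}    P = ↭-refl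
  map-cancel-↭ f-cong f-inj [] {_ ∷ _} P = ⊥-elim (¬x∷xs↭[] (↭-sym P))
  map-cancel-↭ {f} f-cong f-inj (x ∷ xs) {ys} P
    with y , y∈ys , fx≈fy ← ∈-map⁻ S S (∈-resp-↭ P (here ≈-refl))
    with as , bs , w , y≈w , ys≋ ← ∈-∃++ S y∈ys
    = begin
      x ∷ xs            ↭⟨ ↭-prep x (map-cancel-↭ f-cong f-inj xs fxs↭) ⟩
      x ∷ as ++ bs      ↭⟨ ↭-shift as bs ⟨
      as ++ [ x ] ++ bs ↭⟨ ++⁺ˡ as (prep x≈w ↭-refl) ⟩
      as ++ [ w ] ++ bs ≋⟨ ys≋ ⟨
      ys                ∎
    where
    open PermutationReasoning
    x≈w : x ≈ w
    x≈w = ≈-trans (f-inj fx≈fy) y≈w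
    fxs↭ : map f xs ↭ map f (as ++ bs)
    fxs↭ = ↭-trans (dropMiddleElement [] (map f as) (begin
      f x ∷ map f xs                  ↭⟨ P ⟩
      map f ys                        ≋⟨ map⁺ S f-cong ys≋ ⟩
      map f (as ++ [ w ] ++ bs)       ≡⟨ map-++ f as _ ⟩
      map f as ++ [ f w ] ++ map f bs ↭⟨ ++⁺ˡ (map f as) (prep (f-cong (≈-sym x≈w)) ↭-refl) ⟩
      map f as ++ [ f x ] ++ map f bs ∎)) (↭-reflexive (sym (map-++ f as bs)))

-- prime k ps n is ∀ᵏ(P₁ ⇒ … ⇒ Pₘ ⇒ Xₙ) for ps = P₁ … Pₘ; the premises and n
-- live under the k binders.
data Prime : Set where
  prime : ℕ → List Prime → ℕ → Prime

extⁿ : ℕ → (ℕ → ℕ) → ℕ → ℕ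
extⁿ zero    ρ = ρ
extⁿ (suc k) ρ = extⁿ k (ext ρ)

renameᴾ  : (ℕ → ℕ) → Prime → Prime
renameᴾs : (ℕ → ℕ) → List Prime → List Prime
renameᴾ ρ (prime k ps n) = prime k (renameᴾs (extⁿ k ρ) ps) (extⁿ k ρ n)
renameᴾs ρ []       = []
renameᴾs ρ (p ∷ ps) = renameᴾ ρ p ∷ renameᴾs ρ ps

infixr 5 _⇒ᴾ_
_⇒ᴾ_ : List Prime → Prime → Prime
a ⇒ᴾ prime k ps n = prime k (renameᴾs (k +_) a ++ ps) n

∀ᴾ : Prime → Prime
∀ᴾ (prime k ps n) = prime (suc k) ps n

nf : Ty → List Prime
nf (tv n)  = [ prime 0 [] n ]
nf (A ⇒ B) = map (nf A ⇒ᴾ_) (nf B)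
nf (A ∧ B) = nf A ++ nf B
nf (∀' A)  = map ∀ᴾ (nf A)

extⁿ-cong : ∀ k {ρ ρ′} → ρ ≗ ρ′ → extⁿ k ρ ≗ extⁿ k ρ′
extⁿ-cong zero    e = e
extⁿ-cong (suc k) e = extⁿ-cong k (ext-cong e)

extⁿ-∘ : ∀ k ρ σ → extⁿ k ρ ∘ extⁿ k σ ≗ extⁿ k (ρ ∘ σ)
extⁿ-∘ zero    ρ σ x = refl
extⁿ-∘ (suc k) ρ σ x = trans (extⁿ-∘ k (ext ρ) (ext σ) x) (extⁿ-cong k (ext-∘ ρ σ) x)

extⁿ-id : ∀ k {ρ} → ρ ≗ (λ n → n) → extⁿ k ρ ≗ (λ n → n)
extⁿ-id zero    e = e
extⁿ-id (suc k) e = extⁿ-id k λ { zero → refl ; (suc n) → cong suc (e n) }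

extⁿ-+ : ∀ k ρ n → extⁿ k ρ (k + n) ≡ k + ρ n
extⁿ-+ zero    ρ n = refl
extⁿ-+ (suc k) ρ n = begin
  extⁿ k (ext ρ) (suc k + n)  ≡⟨ cong (extⁿ k (ext ρ)) (sym (+-suc k n)) ⟩
  extⁿ k (ext ρ) (k + suc n)  ≡⟨ extⁿ-+ k (ext ρ) (suc n) ⟩
  k + suc (ρ n)               ≡⟨ +-suc k (ρ n) ⟩
  suc k + ρ n                 ∎
  where open ≡-Reasoning

renameᴾ-cong  : ∀ {ρ ρ′} → ρ ≗ ρ′ → renameᴾ ρ ≗ renameᴾ ρ′
renameᴾs-cong : ∀ {ρ ρ′} → ρ ≗ ρ′ → renameᴾs ρ ≗ renameᴾs ρ′
renameᴾ-cong e (prime k ps n) =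
  cong₂ (prime k) (renameᴾs-cong (extⁿ-cong k e) ps) (extⁿ-cong k e n)
renameᴾs-cong e []       = refl
renameᴾs-cong e (p ∷ ps) = cong₂ _∷_ (renameᴾ-cong e p) (renameᴾs-cong e ps)

renameᴾ-∘  : ∀ ρ σ p → renameᴾ ρ (renameᴾ σ p) ≡ renameᴾ (ρ ∘ σ) p
renameᴾs-∘ : ∀ ρ σ ps → renameᴾs ρ (renameᴾs σ ps) ≡ renameᴾs (ρ ∘ σ) ps
renameᴾ-∘ ρ σ (prime k ps n) =
  cong₂ (prime k)
    (trans (renameᴾs-∘ (extⁿ k ρ) (extⁿ k σ) ps) (renameᴾs-cong (extⁿ-∘ k ρ σ) ps))
    (extⁿ-∘ k ρ σ n)
renameᴾs-∘ ρ σ []       = refl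
renameᴾs-∘ ρ σ (p ∷ ps) = cong₂ _∷_ (renameᴾ-∘ ρ σ p) (renameᴾs-∘ ρ σ ps)

renameᴾ-id  : ∀ {ρ} → ρ ≗ (λ n → n) → renameᴾ ρ ≗ (λ p → p)
renameᴾs-id : ∀ {ρ} → ρ ≗ (λ n → n) → renameᴾs ρ ≗ (λ ps → ps)
renameᴾ-id e (prime k ps n) =
  cong₂ (prime k) (renameᴾs-id (extⁿ-id k e) ps) (extⁿ-id k e n)
renameᴾs-id e []       = refl
renameᴾs-id e (p ∷ ps) = cong₂ _∷_ (renameᴾ-id e p) (renameᴾs-id e ps)

renameᴾs-++ : ∀ ρ a b → renameᴾs ρ (a ++ b) ≡ renameᴾs ρ a ++ renameᴾs ρ b
renameᴾs-++ ρ []      b = refl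
renameᴾs-++ ρ (p ∷ a) b = cong (renameᴾ ρ p ∷_) (renameᴾs-++ ρ a b)

renameᴾs-map : ∀ {ρ ρ′} {f g : Prime → Prime} →
               (∀ p → renameᴾ ρ (f p) ≡ g (renameᴾ ρ′ p)) →
               ∀ ps → renameᴾs ρ (map f ps) ≡ map g (renameᴾs ρ′ ps)
renameᴾs-map e []       = refl
renameᴾs-map e (p ∷ ps) = cong₂ _∷_ (e p) (renameᴾs-map e ps)

renameᴾs-extⁿ-comm : ∀ k ρ a → renameᴾs (extⁿ k ρ) (renameᴾs (k +_) a) ≡ renameᴾs (k +_) (renameᴾs ρ a)
renameᴾs-extⁿ-comm k ρ a = begin
  renameᴾs (extⁿ k ρ) (renameᴾs (k +_) a)  ≡⟨ renameᴾs-∘ (extⁿ k ρ) (k +_) a ⟩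
  renameᴾs (extⁿ k ρ ∘ (k +_)) a           ≡⟨ renameᴾs-cong (extⁿ-+ k ρ) a ⟩
  renameᴾs ((k +_) ∘ ρ) a                  ≡⟨ sym (renameᴾs-∘ (k +_) ρ a) ⟩
  renameᴾs (k +_) (renameᴾs ρ a)           ∎
  where open ≡-Reasoning

renameᴾ-⇒ᴾ : ∀ ρ a p → renameᴾ ρ (a ⇒ᴾ p) ≡ renameᴾs ρ a ⇒ᴾ renameᴾ ρ p
renameᴾ-⇒ᴾ ρ a (prime k ps n) = cong (λ qs → prime k qs (extⁿ k ρ n)) (begin
  renameᴾs (extⁿ k ρ) (renameᴾs (k +_) a ++ ps)
    ≡⟨ renameᴾs-++ (extⁿ k ρ) (renameᴾs (k +_) a) ps ⟩
  renameᴾs (extⁿ k ρ) (renameᴾs (k +_) a) ++ renameᴾs (extⁿ k ρ) ps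
    ≡⟨ cong (_++ renameᴾs (extⁿ k ρ) ps) (renameᴾs-extⁿ-comm k ρ a) ⟩
  renameᴾs (k +_) (renameᴾs ρ a) ++ renameᴾs (extⁿ k ρ) ps  ∎)
  where open ≡-Reasoning

renameᴾ-∀ᴾ : ∀ ρ p → renameᴾ ρ (∀ᴾ p) ≡ ∀ᴾ (renameᴾ (ext ρ) p)
renameᴾ-∀ᴾ ρ (prime k ps n) = refl

nf-rename : ∀ ρ A → nf (rename ρ A) ≡ renameᴾs ρ (nf A)
nf-rename ρ (tv n)  = refl
nf-rename ρ (A ⇒ B) =
  trans (cong₂ (λ a b → map (a ⇒ᴾ_) b) (nf-rename ρ A) (nf-rename ρ B))
        (sym (renameᴾs-map (renameᴾ-⇒ᴾ ρ (nf A)) (nf B)))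
nf-rename ρ (A ∧ B) =
  trans (cong₂ _++_ (nf-rename ρ A) (nf-rename ρ B)) (sym (renameᴾs-++ ρ (nf A) (nf B)))
nf-rename ρ (∀' A)  =
  trans (cong (map ∀ᴾ) (nf-rename (ext ρ) A)) (sym (renameᴾs-map (renameᴾ-∀ᴾ ρ) (nf A)))

infix 4 _≈ᴾ_ _↭ᴾ_
data _≈ᴾ_ : Prime → Prime → Set

_↭ᴾ_ : List Prime → List Prime → Set
_↭ᴾ_ = Permutation _≈ᴾ_

data _≈ᴾ_ where
  prime-↭ : ∀ {k ps qs n} → ps ↭ᴾ qs → prime k ps n ≈ᴾ prime k qs n

≈ᴾ-refl : ∀ {p} → p ≈ᴾ p
≋ᴾ-refl : ∀ ps → Pointwise _≈ᴾ_ ps ps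
≈ᴾ-refl {prime k ps n} = prime-↭ (Perm.refl (≋ᴾ-refl ps))
≋ᴾ-refl []       = []
≋ᴾ-refl (p ∷ ps) = ≈ᴾ-refl ∷ ≋ᴾ-refl ps

≈ᴾ-sym : ∀ {p q} → p ≈ᴾ q → q ≈ᴾ p
↭ᴾ-sym : ∀ {ps qs} → ps ↭ᴾ qs → qs ↭ᴾ ps
≋ᴾ-sym : ∀ {ps qs} → Pointwise _≈ᴾ_ ps qs → Pointwise _≈ᴾ_ qs ps
≈ᴾ-sym (prime-↭ P) = prime-↭ (↭ᴾ-sym P)
↭ᴾ-sym (Perm.refl x)     = Perm.refl (≋ᴾ-sym x)
↭ᴾ-sym (prep eq P)       = prep (≈ᴾ-sym eq) (↭ᴾ-sym P)
↭ᴾ-sym (swap eq₁ eq₂ P)  = swap (≈ᴾ-sym eq₂) (≈ᴾ-sym eq₁) (↭ᴾ-sym P)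
↭ᴾ-sym (Perm.trans P Q)  = Perm.trans (↭ᴾ-sym Q) (↭ᴾ-sym P)
≋ᴾ-sym []       = []
≋ᴾ-sym (x ∷ xs) = ≈ᴾ-sym x ∷ ≋ᴾ-sym xs

≈ᴾ-trans : ∀ {p q r} → p ≈ᴾ q → q ≈ᴾ r → p ≈ᴾ r
≈ᴾ-trans (prime-↭ P) (prime-↭ Q) = prime-↭ (Perm.trans P Q)

≈ᴾ-setoid : Setoid _ _
≈ᴾ-setoid = record
  { Carrier       = Prime
  ; _≈_           = _≈ᴾ_
  ; isEquivalence = record { refl = ≈ᴾ-refl ; sym = ≈ᴾ-sym ; trans = ≈ᴾ-trans }
  }

open PermutationSetoid ≈ᴾ-setoid using (↭-refl; ↭-sym; ↭-trans; ↭-reflexive; module PermutationReasoning)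
open PermutationProperties ≈ᴾ-setoid
  using (map⁺; ++⁺; ++⁺ˡ; ++⁺ʳ; ++-comm; ¬x∷xs↭[]; dropMiddle)

renameᴾ-resp-≈ᴾ  : ∀ ρ {p q} → p ≈ᴾ q → renameᴾ ρ p ≈ᴾ renameᴾ ρ q
renameᴾs-resp-↭ᴾ : ∀ ρ {ps qs} → ps ↭ᴾ qs → renameᴾs ρ ps ↭ᴾ renameᴾs ρ qs
renameᴾs-resp-≋ᴾ : ∀ ρ {ps qs} → Pointwise _≈ᴾ_ ps qs →
                   Pointwise _≈ᴾ_ (renameᴾs ρ ps) (renameᴾs ρ qs)
renameᴾ-resp-≈ᴾ ρ (prime-↭ {k} P) = prime-↭ (renameᴾs-resp-↭ᴾ (extⁿ k ρ) P)
renameᴾs-resp-↭ᴾ ρ (Perm.refl x)    = Perm.refl (renameᴾs-resp-≋ᴾ ρ x)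
renameᴾs-resp-↭ᴾ ρ (prep eq P)      = prep (renameᴾ-resp-≈ᴾ ρ eq) (renameᴾs-resp-↭ᴾ ρ P)
renameᴾs-resp-↭ᴾ ρ (swap eq₁ eq₂ P) =
  swap (renameᴾ-resp-≈ᴾ ρ eq₁) (renameᴾ-resp-≈ᴾ ρ eq₂) (renameᴾs-resp-↭ᴾ ρ P)
renameᴾs-resp-↭ᴾ ρ (Perm.trans P Q) = Perm.trans (renameᴾs-resp-↭ᴾ ρ P) (renameᴾs-resp-↭ᴾ ρ Q)
renameᴾs-resp-≋ᴾ ρ []       = []
renameᴾs-resp-≋ᴾ ρ (x ∷ xs) = renameᴾ-resp-≈ᴾ ρ x ∷ renameᴾs-resp-≋ᴾ ρ xs

⇒ᴾ-respʳ-≈ᴾ : ∀ a {p q} → p ≈ᴾ q → a ⇒ᴾ p ≈ᴾ a ⇒ᴾ q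
⇒ᴾ-respʳ-≈ᴾ a (prime-↭ {k} P) = prime-↭ (++⁺ˡ (renameᴾs (k +_) a) P)

⇒ᴾ-respˡ-↭ᴾ : ∀ {a a′} → a ↭ᴾ a′ → ∀ p → a ⇒ᴾ p ≈ᴾ a′ ⇒ᴾ p
⇒ᴾ-respˡ-↭ᴾ P (prime k ps n) = prime-↭ (++⁺ʳ ps (renameᴾs-resp-↭ᴾ (k +_) P))

⇒ᴾ-cancelˡ-≈ᴾ : ∀ a {p q} → a ⇒ᴾ p ≈ᴾ a ⇒ᴾ q → p ≈ᴾ q
⇒ᴾ-cancelˡ-≈ᴾ a {prime k ps n} {prime .k qs .n} (prime-↭ P) = prime-↭ (dropMiddle [] [] P)

∀ᴾ-resp-≈ᴾ : ∀ {p q} → p ≈ᴾ q → ∀ᴾ p ≈ᴾ ∀ᴾ q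
∀ᴾ-resp-≈ᴾ (prime-↭ P) = prime-↭ P

map-resp-≈ᴾ : ∀ {f g : Prime → Prime} → (∀ p → f p ≈ᴾ g p) → ∀ ps → map f ps ↭ᴾ map g ps
map-resp-≈ᴾ {f} {g} e ps = Perm.refl (Pointwise.map⁺ f g (Pointwise.refl (e _)))

⇒ᴾ-++ : ∀ a b p → (a ++ b) ⇒ᴾ p ≡ a ⇒ᴾ (b ⇒ᴾ p)
⇒ᴾ-++ a b (prime k ps n) = cong (λ qs → prime k qs n) (begin
  renameᴾs (k +_) (a ++ b) ++ ps                      ≡⟨ cong (_++ ps) (renameᴾs-++ (k +_) a b) ⟩
  (renameᴾs (k +_) a ++ renameᴾs (k +_) b) ++ ps      ≡⟨ ++-assoc (renameᴾs (k +_) a) _ ps ⟩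
  renameᴾs (k +_) a ++ renameᴾs (k +_) b ++ ps        ∎)
  where open ≡-Reasoning

renameᴾs-+-suc : ∀ k a → renameᴾs (k +_) (renameᴾs suc a) ≡ renameᴾs (suc k +_) a
renameᴾs-+-suc k a = trans (renameᴾs-∘ (k +_) suc a) (renameᴾs-cong (+-suc k) a)

∀ᴾ-⇒ᴾ : ∀ A p → ∀ᴾ (nf (shift A) ⇒ᴾ p) ≡ nf A ⇒ᴾ ∀ᴾ p
∀ᴾ-⇒ᴾ A (prime k ps n) = cong (λ a → prime (suc k) (a ++ ps) n)
  (trans (cong (renameᴾs (k +_)) (nf-rename suc A)) (renameᴾs-+-suc k (nf A)))

nf-resp-≅ : ∀ {A B} → A ≅ B → nf A ↭ᴾ nf B
nf-resp-≅ ≅-refl        = ↭-refl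
nf-resp-≅ (≅-sym p)     = ↭-sym (nf-resp-≅ p)
nf-resp-≅ (≅-trans p q) = ↭-trans (nf-resp-≅ p) (nf-resp-≅ q)
nf-resp-≅ (≅-⇒ {A} {B' = B′} p q) =
  ↭-trans (map⁺ ≈ᴾ-setoid (⇒ᴾ-respʳ-≈ᴾ (nf A)) (nf-resp-≅ q))
          (map-resp-≈ᴾ (⇒ᴾ-respˡ-↭ᴾ (nf-resp-≅ p)) (nf B′))
nf-resp-≅ (≅-∧ p q)     = ++⁺ (nf-resp-≅ p) (nf-resp-≅ q)
nf-resp-≅ (≅-∀ p)       = map⁺ ≈ᴾ-setoid ∀ᴾ-resp-≈ᴾ (nf-resp-≅ p)
nf-resp-≅ (comm {A} {B})      = ++-comm (nf A) (nf B)
nf-resp-≅ (asso {A} {B} {C})  = ↭-reflexive (sym (++-assoc (nf A) (nf B) (nf C)))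
nf-resp-≅ (dist {A} {B} {C})  = ↭-reflexive (map-++ (nf A ⇒ᴾ_) (nf B) (nf C))
nf-resp-≅ (curry {A} {B} {C}) = ↭-reflexive
  (trans (map-cong (⇒ᴾ-++ (nf A) (nf B)) (nf C)) (map-∘ (nf C)))
nf-resp-≅ (p-comm {A} {B})    = ↭-reflexive
  (trans (sym (map-∘ (nf B))) (trans (map-cong (∀ᴾ-⇒ᴾ A) (nf B)) (map-∘ (nf B))))
nf-resp-≅ (p-dist {A} {B})    = ↭-reflexive (map-++ ∀ᴾ (nf A) (nf B))

∀ⁿ : ℕ → Ty → Ty
∀ⁿ zero    A = A
∀ⁿ (suc k) A = ∀' (∀ⁿ k A)

infixr 8 _⇛_
⌜_⌝ : Prime → Ty
_⇛_ : List Prime → Ty → Ty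
⌜ prime k ps n ⌝ = ∀ⁿ k (ps ⇛ tv n)
[]       ⇛ A = A
(p ∷ ps) ⇛ A = ⌜ p ⌝ ⇒ ps ⇛ A

-- The value on [] is junk: nf never produces the empty list.
⋀ : List Prime → Ty
⋀ []           = tv 0
⋀ (p ∷ [])     = ⌜ p ⌝
⋀ (p ∷ q ∷ ps) = ⌜ p ⌝ ∧ ⋀ (q ∷ ps)

NonEmpty : List Prime → Set
NonEmpty []      = ⊥
NonEmpty (_ ∷ _) = ⊤

∀ⁿ-resp-≅ : ∀ k {A B} → A ≅ B → ∀ⁿ k A ≅ ∀ⁿ k B
∀ⁿ-resp-≅ zero    e = e
∀ⁿ-resp-≅ (suc k) e = ≅-∀ (∀ⁿ-resp-≅ k e)

⌜⌝-resp-≈ᴾ : ∀ {p q} → p ≈ᴾ q → ⌜ p ⌝ ≅ ⌜ q ⌝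
⇛-resp-↭ᴾ  : ∀ {ps qs} A → ps ↭ᴾ qs → ps ⇛ A ≅ qs ⇛ A
⇛-resp-≋ᴾ  : ∀ {ps qs} A → Pointwise _≈ᴾ_ ps qs → ps ⇛ A ≅ qs ⇛ A
⌜⌝-resp-≈ᴾ (prime-↭ {k} {n = n} P) = ∀ⁿ-resp-≅ k (⇛-resp-↭ᴾ (tv n) P)
⇛-resp-↭ᴾ A (Perm.refl x)    = ⇛-resp-≋ᴾ A x
⇛-resp-↭ᴾ A (prep eq P)      = ≅-⇒ (⌜⌝-resp-≈ᴾ eq) (⇛-resp-↭ᴾ A P)
⇛-resp-↭ᴾ A (swap eq₁ eq₂ P) =
  ≅-trans (≅-sym curry) (≅-trans (≅-⇒ comm ≅-refl) (≅-trans curry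
    (≅-⇒ (⌜⌝-resp-≈ᴾ eq₂) (≅-⇒ (⌜⌝-resp-≈ᴾ eq₁) (⇛-resp-↭ᴾ A P)))))
⇛-resp-↭ᴾ A (Perm.trans P Q) = ≅-trans (⇛-resp-↭ᴾ A P) (⇛-resp-↭ᴾ A Q)
⇛-resp-≋ᴾ A []       = ≅-refl
⇛-resp-≋ᴾ A (x ∷ xs) = ≅-⇒ (⌜⌝-resp-≈ᴾ x) (⇛-resp-≋ᴾ A xs)

⋀-resp-↭ᴾ : ∀ {ps qs} → ps ↭ᴾ qs → ⋀ ps ≅ ⋀ qs
⋀-resp-≋ᴾ : ∀ {ps qs} → Pointwise _≈ᴾ_ ps qs → ⋀ ps ≅ ⋀ qs
⋀-resp-↭ᴾ (Perm.refl x)                        = ⋀-resp-≋ᴾ x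
⋀-resp-↭ᴾ (prep {[]}    {[]}    eq P)          = ⌜⌝-resp-≈ᴾ eq
⋀-resp-↭ᴾ (prep {[]}    {_ ∷ _} eq P)          = ⊥-elim (¬x∷xs↭[] (↭-sym P))
⋀-resp-↭ᴾ (prep {_ ∷ _} {[]}    eq P)          = ⊥-elim (¬x∷xs↭[] P)
⋀-resp-↭ᴾ (prep {_ ∷ _} {_ ∷ _} eq P)          = ≅-∧ (⌜⌝-resp-≈ᴾ eq) (⋀-resp-↭ᴾ P)
⋀-resp-↭ᴾ (swap {[]}    {[]}    eq₁ eq₂ P)     =
  ≅-trans comm (≅-∧ (⌜⌝-resp-≈ᴾ eq₂) (⌜⌝-resp-≈ᴾ eq₁))
⋀-resp-↭ᴾ (swap {[]}    {_ ∷ _} eq₁ eq₂ P)     = ⊥-elim (¬x∷xs↭[] (↭-sym P))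
⋀-resp-↭ᴾ (swap {_ ∷ _} {[]}    eq₁ eq₂ P)     = ⊥-elim (¬x∷xs↭[] P)
⋀-resp-↭ᴾ (swap {_ ∷ _} {_ ∷ _} eq₁ eq₂ P)     =
  ≅-trans asso (≅-trans (≅-∧ comm ≅-refl) (≅-trans (≅-sym asso)
    (≅-∧ (⌜⌝-resp-≈ᴾ eq₂) (≅-∧ (⌜⌝-resp-≈ᴾ eq₁) (⋀-resp-↭ᴾ P)))))
⋀-resp-↭ᴾ (Perm.trans P Q)                     = ≅-trans (⋀-resp-↭ᴾ P) (⋀-resp-↭ᴾ Q)
⋀-resp-≋ᴾ []                = ≅-refl
⋀-resp-≋ᴾ (x ∷ [])          = ⌜⌝-resp-≈ᴾ x
⋀-resp-≋ᴾ (x ∷ xs@(_ ∷ _))  = ≅-∧ (⌜⌝-resp-≈ᴾ x) (⋀-resp-≋ᴾ xs)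

∀ⁿ-rename : ∀ k ρ A → rename ρ (∀ⁿ k A) ≡ ∀ⁿ k (rename (extⁿ k ρ) A)
∀ⁿ-rename zero    ρ A = refl
∀ⁿ-rename (suc k) ρ A = cong ∀' (∀ⁿ-rename k (ext ρ) A)

⌜⌝-rename : ∀ ρ p → ⌜ renameᴾ ρ p ⌝ ≡ rename ρ ⌜ p ⌝
⇛-rename  : ∀ ρ ps A → renameᴾs ρ ps ⇛ rename ρ A ≡ rename ρ (ps ⇛ A)
⌜⌝-rename ρ (prime k ps n) =
  trans (cong (∀ⁿ k) (⇛-rename (extⁿ k ρ) ps (tv n))) (sym (∀ⁿ-rename k ρ _))
⇛-rename ρ []       A = refl
⇛-rename ρ (p ∷ ps) A = cong₂ _⇒_ (⌜⌝-rename ρ p) (⇛-rename ρ ps A)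

⋀-rename : ∀ ρ a → NonEmpty a → ⋀ (renameᴾs ρ a) ≡ rename ρ (⋀ a)
⋀-rename ρ (p ∷ [])     _ = ⌜⌝-rename ρ p
⋀-rename ρ (p ∷ q ∷ a)  _ = cong₂ _∧_ (⌜⌝-rename ρ p) (⋀-rename ρ (q ∷ a) tt)

⇛-++ : ∀ a b A → (a ++ b) ⇛ A ≡ a ⇛ b ⇛ A
⇛-++ []      b A = refl
⇛-++ (p ∷ a) b A = cong (⌜ p ⌝ ⇒_) (⇛-++ a b A)

⇛-curry : ∀ a A → NonEmpty a → a ⇛ A ≅ ⋀ a ⇒ A
⇛-curry (p ∷ [])    A _ = ≅-refl
⇛-curry (p ∷ q ∷ a) A _ = ≅-trans (≅-⇒ ≅-refl (⇛-curry (q ∷ a) A tt)) (≅-sym curry)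

⋀-++ : ∀ a b → NonEmpty a → NonEmpty b → ⋀ (a ++ b) ≅ ⋀ a ∧ ⋀ b
⋀-++ (p ∷ [])    (q ∷ b) _ _  = ≅-refl
⋀-++ (p ∷ q ∷ a) b       _ nb = ≅-trans (≅-∧ ≅-refl (⋀-++ (q ∷ a) b tt nb)) asso

-- Each binder passed is an instance of p-comm, which is why the premises are
-- shifted by k in a ⇒ᴾ p.
∀ⁿ-⇛ : ∀ k a ps A → NonEmpty a →
       ∀ⁿ k ((renameᴾs (k +_) a ++ ps) ⇛ A) ≅ ⋀ a ⇒ ∀ⁿ k (ps ⇛ A)
∀ⁿ-⇛ zero a ps A ne = begin
  (renameᴾs (λ n → n) a ++ ps) ⇛ A  ≡⟨ cong (λ b → (b ++ ps) ⇛ A) (renameᴾs-id (λ _ → refl) a) ⟩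
  (a ++ ps) ⇛ A                     ≡⟨ ⇛-++ a ps A ⟩
  a ⇛ ps ⇛ A                        ≈⟨ ⇛-curry a _ ne ⟩
  ⋀ a ⇒ ps ⇛ A                      ∎
  where open ≅-Reasoning
∀ⁿ-⇛ (suc k) a ps A ne = begin
  ∀' (∀ⁿ k ((renameᴾs (suc k +_) a ++ ps) ⇛ A))
    ≡⟨ cong (λ b → ∀' (∀ⁿ k ((b ++ ps) ⇛ A))) (sym (renameᴾs-+-suc k a)) ⟩
  ∀' (∀ⁿ k ((renameᴾs (k +_) (renameᴾs suc a) ++ ps) ⇛ A))
    ≈⟨ ≅-∀ (∀ⁿ-⇛ k (renameᴾs suc a) ps A (nonEmpty-rename a ne)) ⟩
  ∀' (⋀ (renameᴾs suc a) ⇒ ∀ⁿ k (ps ⇛ A))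
    ≡⟨ cong (λ B → ∀' (B ⇒ ∀ⁿ k (ps ⇛ A))) (⋀-rename suc a ne) ⟩
  ∀' (shift (⋀ a) ⇒ ∀ⁿ k (ps ⇛ A))
    ≈⟨ p-comm ⟩
  ⋀ a ⇒ ∀' (∀ⁿ k (ps ⇛ A))
    ∎
  where
  open ≅-Reasoning
  nonEmpty-rename : ∀ a → NonEmpty a → NonEmpty (renameᴾs suc a)
  nonEmpty-rename (_ ∷ _) _ = tt

⋀-map-⇒ᴾ : ∀ a b → NonEmpty a → NonEmpty b → ⋀ (map (a ⇒ᴾ_) b) ≅ ⋀ a ⇒ ⋀ b
⋀-map-⇒ᴾ a (prime k ps n ∷ [])    na _ = ∀ⁿ-⇛ k a ps (tv n) na
⋀-map-⇒ᴾ a (prime k ps n ∷ q ∷ b)  na _ =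
  ≅-trans (≅-∧ (∀ⁿ-⇛ k a ps (tv n) na) (⋀-map-⇒ᴾ a (q ∷ b) na tt)) (≅-sym dist)

⋀-map-∀ᴾ : ∀ b → NonEmpty b → ⋀ (map ∀ᴾ b) ≅ ∀' (⋀ b)
⋀-map-∀ᴾ (prime k ps n ∷ [])    _ = ≅-refl
⋀-map-∀ᴾ (prime k ps n ∷ q ∷ b) _ = ≅-trans (≅-∧ ≅-refl (⋀-map-∀ᴾ (q ∷ b) tt)) (≅-sym p-dist)

nf-nonEmpty : ∀ A → NonEmpty (nf A)
nf-nonEmpty (tv n)  = tt
nf-nonEmpty (A ⇒ B) with nf B | nf-nonEmpty B
... | _ ∷ _ | _ = tt
nf-nonEmpty (A ∧ B) with nf A | nf-nonEmpty A
... | _ ∷ _ | _ = tt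
nf-nonEmpty (∀' A)  with nf A | nf-nonEmpty A
... | _ ∷ _ | _ = tt

⋀-nf : ∀ A → ⋀ (nf A) ≅ A
⋀-nf (tv n)  = ≅-refl
⋀-nf (A ⇒ B) = ≅-trans (⋀-map-⇒ᴾ (nf A) (nf B) (nf-nonEmpty A) (nf-nonEmpty B)) (≅-⇒ (⋀-nf A) (⋀-nf B))
⋀-nf (A ∧ B) = ≅-trans (⋀-++ (nf A) (nf B) (nf-nonEmpty A) (nf-nonEmpty B)) (≅-∧ (⋀-nf A) (⋀-nf B))
⋀-nf (∀' A)  = ≅-trans (⋀-map-∀ᴾ (nf A) (nf-nonEmpty A)) (≅-∀ (⋀-nf A))

nf-↭ᴾ⇒≅ : ∀ {A B} → nf A ↭ᴾ nf B → A ≅ B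
nf-↭ᴾ⇒≅ {A} {B} P = ≅-trans (≅-sym (⋀-nf A)) (≅-trans (⋀-resp-↭ᴾ P) (⋀-nf B))

⇒-cancel-≅ : ∀ {A B A′ B′} → A ⇒ B ≅ A′ ⇒ B′ → A ≅ A′ → B ≅ B′
⇒-cancel-≅ {A} {B} {A′} {B′} e a = nf-↭ᴾ⇒≅
  (map-cancel-↭ ≈ᴾ-setoid (⇒ᴾ-respʳ-≈ᴾ (nf A)) (⇒ᴾ-cancelˡ-≈ᴾ (nf A)) (nf B) (begin
    map (nf A ⇒ᴾ_) (nf B)   ↭⟨ nf-resp-≅ e ⟩
    map (nf A′ ⇒ᴾ_) (nf B′) ↭⟨ map-resp-≈ᴾ (⇒ᴾ-respˡ-↭ᴾ (nf-resp-≅ a)) (nf B′) ⟨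
    map (nf A ⇒ᴾ_) (nf B′)  ∎))
  where open PermutationReasoning

⊢-unique : ∀ {Γ r A B} → Γ ⊢ r ∶ A → Γ ⊢ r ∶ B → A ≅ B
⊢-unique (iso d e)  d′          = ≅-trans (≅-sym e) (⊢-unique d d′)
⊢-unique d          (iso d′ e)  = ≅-trans (⊢-unique d d′) e
⊢-unique (ax e)     (ax e′)     = ≡⇒≅ (just-injective (trans (sym e) e′))
⊢-unique (⇒I d)     (⇒I d′)     = ≅-⇒ ≅-refl (⊢-unique d d′)
⊢-unique (⇒E d a)   (⇒E d′ a′)  = ⇒-cancel-≅ (⊢-unique d d′) (⊢-unique a a′)
⊢-unique (∧I d e)   (∧I d′ e′)  = ≅-∧ (⊢-unique d d′) (⊢-unique e e′)
⊢-unique (∧E d)     (∧E d′)     = ≅-refl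
⊢-unique (∀I d)     (∀I d′)     = ≅-∀ (⊢-unique d d′)
⊢-unique (∀E {B = C} d) (∀E d′) = subst-resp-≅ (sub0 C) (∀-cancel-≅ (⊢-unique d d′))

mainTheorem10 : (Γ : Ctx) (r : Term) (A B : Ty) → Γ ⊢ r ∶ A → Γ ⊢ r ∶ B → A ≅ B
mainTheorem10 Γ r A B = ⊢-unique
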